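{- For each $u \in \{4,5,8\}$ there exists an SBGDD$_0$ of type $3^u$.
   Context: For a multiset $\mathcal{B}$ of subsets of a set $V$ and $X \subseteq V$, the frequency of $X$ is the number of members of $\mathcal{B}$ (counted with multiplicity) containing $X$. An SBGDD$_\mu$ of type $g^u$ is a triple $(V,\Pi,\mathcal{B})$ where $V$ is a set of $gu$ points, $\Pi$ is a partition of $V$ into $u$ groups each of size $g$, and $\mathcal{B}$ is a multiset of 3-element subsets of $V$, such that every pair of points in the same group has frequency $0$, and the frequencies of pairs of points in different groups are pairwise distinct and form exactly the set $\{\mu,\dots,\mu+g^2\binom{u}{2}-1\}$. -}

module Defs where

open import Data.Nat using (ℕ; _+_; _*_; _∸_; _≤_; _<_)
open import Data.Nat.Combinatorics using (_C_)
open import Data.Bool using (Bool; _∧_)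
open import Data.Fin using (Fin; _≟_)
open import Data.Fin.Subset using (Subset; ∣_∣)
open import Data.Vec using (lookup)
open import Data.List using (List; length; filter; filterᵇ; allFin)
import Data.List.Membership.Propositional
open import Data.Product using (_×_; Σ; ∃-syntax)
open import Data.Sum using (_⊎_)
open import Relation.Binary.PropositionalEquality using (_≡_; _≢_)

-- Points are Fin (g * u).  A partition of the points into u groups is given
-- by the group-assignment map  grp : Fin (g * u) → Fin u.

groupSize : ∀ {n u} → (Fin n → Fin u) → Fin u → ℕ
groupSize {n} grp i = length (filter (λ x → grp x ≟ i) (allFin n))

pairFreq : ∀ {n} → List (Subset n) → Fin n → Fin n → ℕ
pairFreq B x y = length (filterᵇ (λ b → lookup b x ∧ lookup b y) B)

record IsSBGDD (μ g u : ℕ) (grp : Fin (g * u) → Fin u)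
               (B : List (Subset (g * u))) : Set where
  field
    groupsOfSizeG : ∀ i → groupSize grp i ≡ g
    blocksTriples : ∀ {b} → b Data.List.Membership.Propositional.∈ B → ∣ b ∣ ≡ 3
    sameGroupZero : ∀ x y → x ≢ y → grp x ≡ grp y → pairFreq B x y ≡ 0
    crossDistinct : ∀ x y x′ y′ → grp x ≢ grp y → grp x′ ≢ grp y′ →
                    pairFreq B x y ≡ pairFreq B x′ y′ →
                    (x ≡ x′ × y ≡ y′) ⊎ (x ≡ y′ × y ≡ x′)
    crossInRange  : ∀ x y → grp x ≢ grp y →
                    μ ≤ pairFreq B x y × pairFreq B x y < μ + g * g * (u C 2)
    crossOnto     : ∀ k → μ ≤ k → k < μ + g * g * (u C 2) →
                    ∃[ x ] ∃[ y ] (grp x ≢ grp y × pairFreq B x y ≡ k)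

SBGDDExists : ℕ → ℕ → ℕ → Set
SBGDDExists μ g u = ∃[ grp ] ∃[ B ] IsSBGDD μ g u grp B

{-# OPTIONS --safe #-}
module Submission where

open import Data.Bool using (true; false; _∧_; _∨_; if_then_else_)
open import Data.Fin as Fin using (Fin; toℕ; fromℕ<; remainder; _≤?_)
open import Data.Fin.Properties using (toℕ-fromℕ<; all?)
open import Data.Fin.Subset using (Subset; ∣_∣)
open import Data.List using (List; []; _∷_; _++_; replicate; length; filterᵇ; head; drop)
open import Data.List.Properties using (filter-++; length-++)
open import Data.List.Relation.Unary.All as All using (All)
open import Data.List.Relation.Unary.All.Properties using (++⁺; replicate⁺)
open import Data.Maybe using (fromMaybe)
open import Data.Nat as ℕ using (ℕ; zero; suc; _+_; _*_; _<_; _<?_; _≡ᵇ_; z≤n)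
open import Data.Nat.DivMod using (_mod_)
open import Data.Nat.Combinatorics using (_C_)
open import Data.Product as Product using (_×_; _,_; proj₁; proj₂; ∃-syntax)
open import Data.Product.Properties using (≡-dec)
open import Data.Sum using (_⊎_; inj₁; inj₂)
open import Data.Unit using (tt)
open import Data.Vec using (lookup; tabulate)
open import Function using (_∘_)
open import Relation.Nullary using (Dec; does; ¬?)
open import Relation.Nullary.Decidable using (True; toWitness; map′; _×-dec_; _→-dec_)
open import Relation.Binary.PropositionalEquality
  using (_≡_; _≢_; refl; sym; trans; cong; cong₂; subst; module ≡-Reasoning)

open import Defs

-- The designs come from a computer search; they are verified by evaluation.
-- Besides the blocks (with multiplicities) a certificate lists, for each
-- k < 9·C(u,2), the cross pair of frequency k. Checking that every cross
-- pair {x,y} is listed at position freq(x,y) (and that this is below 9·C(u,2))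
-- makes cross frequencies pairwise distinct; checking that the pair listed at
-- k really has frequency k makes them exhaust the range.

WeightedBlocks : ℕ → Set
WeightedBlocks n = List (ℕ × Subset n)

expand : ∀ {n} → WeightedBlocks n → List (Subset n)
expand [] = []
expand ((k , b) ∷ L) = replicate k b ++ expand L

weightedPairFreq : ∀ {n} → WeightedBlocks n → Fin n → Fin n → ℕ
weightedPairFreq [] x y = 0
weightedPairFreq ((k , b) ∷ L) x y =
  (if lookup b x ∧ lookup b y then k else 0) + weightedPairFreq L x y

module _ {n} (x y : Fin n) where

  pairFreq-++ : ∀ bs cs → pairFreq (bs ++ cs) x y ≡ pairFreq bs x y + pairFreq cs x y
  pairFreq-++ bs cs = trans (cong length (filter-++ _ bs cs)) (length-++ (filterᵇ _ bs))

  pairFreq-replicate : ∀ k b →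
    pairFreq (replicate k b) x y ≡ (if lookup b x ∧ lookup b y then k else 0)
  pairFreq-replicate zero b with lookup b x ∧ lookup b y
  ... | true  = refl
  ... | false = refl
  pairFreq-replicate (suc k) b with lookup b x ∧ lookup b y | pairFreq-replicate k b
  ... | true  | ih = cong suc ih
  ... | false | ih = ih

  pairFreq-expand : ∀ L → pairFreq (expand L) x y ≡ weightedPairFreq L x y
  pairFreq-expand [] = refl
  pairFreq-expand ((k , b) ∷ L) = begin
    pairFreq (replicate k b ++ expand L) x y                 ≡⟨ pairFreq-++ (replicate k b) (expand L) ⟩
    pairFreq (replicate k b) x y + pairFreq (expand L) x y   ≡⟨ cong₂ _+_ (pairFreq-replicate k b) (pairFreq-expand L) ⟩
    weightedPairFreq ((k , b) ∷ L) x y                       ∎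
    where open ≡-Reasoning

blocksThrough : ∀ {n} → Fin n → WeightedBlocks n → WeightedBlocks n
blocksThrough x = filterᵇ (λ kb → lookup (proj₂ kb) x)

weightedPairFreq-blocksThrough : ∀ {n} (L : WeightedBlocks n) x y →
  weightedPairFreq (blocksThrough x L) x y ≡ weightedPairFreq L x y
weightedPairFreq-blocksThrough [] x y = refl
weightedPairFreq-blocksThrough ((k , b) ∷ L) x y with lookup b x in b∋x
... | true  rewrite b∋x = cong (_ +_) (weightedPairFreq-blocksThrough L x y)
... | false = weightedPairFreq-blocksThrough L x y

All-expand : ∀ {n p} {P : Subset n → Set p} (L : WeightedBlocks n) →
  All (P ∘ proj₂) L → All P (expand L)
All-expand [] All.[] = All.[]
All-expand ((k , b) ∷ L) (Pb All.∷ PL) = ++⁺ (replicate⁺ k Pb) (All-expand L PL)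

orderedPair : ∀ {n} → Fin n → Fin n → Fin n × Fin n
orderedPair x y = if does (x ≤? y) then (x , y) else (y , x)

orderedPair-≡⇒sameEnds : ∀ {n} (x y x′ y′ : Fin n) → orderedPair x y ≡ orderedPair x′ y′ →
  (x ≡ x′ × y ≡ y′) ⊎ (x ≡ y′ × y ≡ x′)
orderedPair-≡⇒sameEnds x y x′ y′ eq with does (x ≤? y) | does (x′ ≤? y′) | eq
... | true  | true  | refl = inj₁ (refl , refl)
... | true  | false | refl = inj₂ (refl , refl)
... | false | true  | refl = inj₂ (refl , refl)
... | false | false | refl = inj₁ (refl , refl)

module _ (u : ℕ) where

  Point : Set
  Point = Fin (3 * u)

  -- the point x lies in group x mod u
  group : Point → Fin u
  group = remainder {3} u

  crossPairCount : ℕ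
  crossPairCount = 3 * 3 * (u C 2)

  record Certificate : Set where
    field
      blocks       : WeightedBlocks (3 * u)
      pairWithFreq : ℕ → Point × Point

  module _ (c : Certificate) where
    open Certificate c

    FreqCondition : Point → Point → ℕ → Set
    FreqCondition x y v =
      (group x ≡ group y → x ≢ y → v ≡ 0) ×
      (group x ≢ group y → pairWithFreq v ≡ orderedPair x y × v < crossPairCount)

    freqCondition? : ∀ x y v → Dec (FreqCondition x y v)
    freqCondition? x y v =
      (group x Fin.≟ group y →-dec ¬? (x Fin.≟ y) →-dec v ℕ.≟ 0) ×-dec
      (¬? (group x Fin.≟ group y) →-dec
         ≡-dec Fin._≟_ Fin._≟_ (pairWithFreq v) (orderedPair x y) ×-dec v <? crossPairCount)

    -- Scanning only the blocks through x keeps the row of x cheap to evaluate.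
    RowCondition : Point → WeightedBlocks (3 * u) → Set
    RowCondition x L = ∀ y → FreqCondition x y (weightedPairFreq L x y)

    rowCondition? : ∀ x L → Dec (RowCondition x L)
    rowCondition? x L = all? λ y → freqCondition? x y (weightedPairFreq L x y)

    AttainsFreq : ℕ → Point × Point → Set
    AttainsFreq k (a , b) = group a ≢ group b × weightedPairFreq blocks a b ≡ k

    attainsFreq? : ∀ k p → Dec (AttainsFreq k p)
    attainsFreq? k (a , b) = ¬? (group a Fin.≟ group b) ×-dec weightedPairFreq blocks a b ℕ.≟ k

    record Valid : Set where
      constructor mkValid
      field
        groupSizes : ∀ i → groupSize group i ≡ 3
        blockSizes : All (λ kb → ∣ proj₂ kb ∣ ≡ 3) blocks
        rows       : ∀ x → RowCondition x (blocksThrough x blocks)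
        attained   : ∀ (k : Fin crossPairCount) → AttainsFreq (toℕ k) (pairWithFreq (toℕ k))

    valid? : Dec Valid
    valid? = map′ (λ (g , b , r , a) → mkValid g b r a) (λ (mkValid g b r a) → g , b , r , a)
      (all? (λ i → groupSize group i ℕ.≟ 3)
        ×-dec All.all? (λ kb → ∣ proj₂ kb ∣ ℕ.≟ 3) blocks
        ×-dec all? (λ x → rowCondition? x (blocksThrough x blocks))
        ×-dec all? (λ k → attainsFreq? (toℕ k) (pairWithFreq (toℕ k))))

    module _ (valid : Valid) where
      open Valid valid

      freqCondition : ∀ x y → FreqCondition x y (pairFreq (expand blocks) x y)
      freqCondition x y = subst (FreqCondition x y)
        (trans (weightedPairFreq-blocksThrough blocks x y) (sym (pairFreq-expand x y blocks)))
        (rows x y)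

      crossPairs-distinct : ∀ x y x′ y′ → group x ≢ group y → group x′ ≢ group y′ →
        pairFreq (expand blocks) x y ≡ pairFreq (expand blocks) x′ y′ →
        (x ≡ x′ × y ≡ y′) ⊎ (x ≡ y′ × y ≡ x′)
      crossPairs-distinct x y x′ y′ gx≢gy gx′≢gy′ eq = orderedPair-≡⇒sameEnds x y x′ y′ (begin
        orderedPair x y                               ≡⟨ sym (pairOf x y gx≢gy) ⟩
        pairWithFreq (pairFreq (expand blocks) x y)   ≡⟨ cong pairWithFreq eq ⟩
        pairWithFreq (pairFreq (expand blocks) x′ y′) ≡⟨ pairOf x′ y′ gx′≢gy′ ⟩
        orderedPair x′ y′                             ∎)
        where
        open ≡-Reasoning
        pairOf : ∀ x y → group x ≢ group y →
                 pairWithFreq (pairFreq (expand blocks) x y) ≡ orderedPair x y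
        pairOf x y gx≢gy = proj₁ (proj₂ (freqCondition x y) gx≢gy)

      attainedBelow : ∀ k → k < crossPairCount → AttainsFreq k (pairWithFreq k)
      attainedBelow k k<N =
        subst (λ j → AttainsFreq j (pairWithFreq j)) (toℕ-fromℕ< k<N) (attained (fromℕ< k<N))

      crossPairs-onto : ∀ k → k < crossPairCount →
        ∃[ x ] ∃[ y ] (group x ≢ group y × pairFreq (expand blocks) x y ≡ k)
      crossPairs-onto k k<N with pairWithFreq k | attainedBelow k k<N
      ... | x , y | gx≢gy , freq≡k = x , y , gx≢gy , trans (pairFreq-expand x y blocks) freq≡k

      isSBGDD : IsSBGDD 0 3 u group (expand blocks)
      isSBGDD = record
        { groupsOfSizeG = groupSizes
        ; blocksTriples = All.lookup (All-expand blocks blockSizes)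
        ; sameGroupZero = λ x y x≢y gx≡gy → proj₁ (freqCondition x y) gx≡gy x≢y
        ; crossDistinct = crossPairs-distinct
        ; crossInRange  = λ x y gx≢gy → z≤n , proj₂ (proj₂ (freqCondition x y) gx≢gy)
        ; crossOnto     = λ k _ → crossPairs-onto k
        }

  certifiedSBGDD : (c : Certificate) → True (valid? c) → SBGDDExists 0 3 u
  certifiedSBGDD c ok = group , expand (Certificate.blocks c) , isSBGDD c (toWitness ok)

-- Out-of-range indices are junk (dropped by triple, reduced mod 3u by fromTables);
-- valid? checks every block and every pair actually used, so they do no harm.
triple : ∀ {n} → ℕ → ℕ → ℕ → Subset n
triple a b c = tabulate λ i → (toℕ i ≡ᵇ a) ∨ (toℕ i ≡ᵇ b) ∨ (toℕ i ≡ᵇ c)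

fromTables : ∀ {m} → WeightedBlocks (3 * suc m) → List (ℕ × ℕ) → Certificate (suc m)
fromTables {m} blocks pairs = record
  { blocks       = blocks
  ; pairWithFreq = λ k → Product.map point point (fromMaybe (0 , 0) (head (drop k pairs)))
  }
  where
  point : ℕ → Point (suc m)
  point a = a mod (3 * suc m)

blocks₄ : WeightedBlocks 12
blocks₄ =
  (26 , triple 0 1 2) ∷ (8 , triple 0 1 3) ∷ (13 , triple 0 1 7) ∷ (1 , triple 0 2 3) ∷ (2 , triple 0 2 7) ∷ (17 , triple 0 2 11) ∷
  (1 , triple 0 3 6) ∷ (4 , triple 0 3 9) ∷ (4 , triple 0 3 10) ∷ (8 , triple 0 7 9) ∷ (12 , triple 0 7 10) ∷ (2 , triple 0 9 11) ∷
  (26 , triple 0 10 11) ∷ (1 , triple 1 2 3) ∷ (21 , triple 1 2 8) ∷ (5 , triple 1 3 4) ∷ (7 , triple 1 3 8) ∷ (6 , triple 1 3 10) ∷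
  (1 , triple 1 4 6) ∷ (4 , triple 1 4 7) ∷ (1 , triple 1 4 10) ∷ (2 , triple 1 4 11) ∷ (3 , triple 1 6 7) ∷ (1 , triple 1 6 8) ∷
  (2 , triple 1 6 11) ∷ (22 , triple 1 7 8) ∷ (8 , triple 1 7 10) ∷ (2 , triple 1 8 10) ∷ (2 , triple 1 10 11) ∷ (1 , triple 2 3 4) ∷
  (1 , triple 2 3 5) ∷ (15 , triple 2 4 7) ∷ (2 , triple 2 4 9) ∷ (14 , triple 2 4 11) ∷ (6 , triple 2 5 7) ∷ (1 , triple 2 5 8) ∷
  (13 , triple 2 7 9) ∷ (11 , triple 2 8 9) ∷ (1 , triple 2 8 11) ∷ (7 , triple 2 9 11) ∷ (5 , triple 3 4 5) ∷ (4 , triple 3 4 9) ∷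
  (5 , triple 3 4 10) ∷ (2 , triple 3 5 6) ∷ (16 , triple 3 5 10) ∷ (3 , triple 3 6 8) ∷ (5 , triple 3 6 9) ∷ (4 , triple 3 8 9) ∷
  (7 , triple 3 8 10) ∷ (6 , triple 3 9 10) ∷ (1 , triple 4 5 7) ∷ (3 , triple 4 5 10) ∷ (1 , triple 4 6 9) ∷ (1 , triple 4 7 9) ∷
  (10 , triple 4 7 10) ∷ (4 , triple 4 9 10) ∷ (3 , triple 4 9 11) ∷ (6 , triple 4 10 11) ∷ (3 , triple 5 6 7) ∷ (10 , triple 5 7 8) ∷
  (20 , triple 5 7 10) ∷ (1 , triple 5 8 10) ∷ (3 , triple 5 10 11) ∷ (4 , triple 6 7 9) ∷ (8 , triple 6 8 9) ∷ (5 , triple 6 8 11) ∷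
  (19 , triple 6 9 11) ∷ (4 , triple 7 8 9) ∷ (2 , triple 7 8 10) ∷ (1 , triple 8 9 10) ∷ (13 , triple 8 9 11) ∷ (9 , triple 8 10 11) ∷
  (5 , triple 9 10 11) ∷
  []

pairsByFreq₄ : List (ℕ × ℕ)
pairsByFreq₄ =
  (0 , 5) ∷ (0 , 6) ∷ (4 , 6) ∷ (5 , 11) ∷ (2 , 3) ∷ (5 , 6) ∷ (1 , 11) ∷ (1 , 6) ∷ (2 , 5) ∷ (4 , 5) ∷
  (6 , 7) ∷ (3 , 6) ∷ (5 , 8) ∷ (1 , 4) ∷ (0 , 9) ∷ (4 , 9) ∷ (9 , 10) ∷ (6 , 8) ∷ (0 , 3) ∷ (1 , 10) ∷
  (3 , 4) ∷ (3 , 8) ∷ (8 , 10) ∷ (3 , 9) ∷ (3 , 5) ∷ (4 , 11) ∷ (6 , 11) ∷ (1 , 3) ∷ (8 , 11) ∷ (4 , 10) ∷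
  (7 , 9) ∷ (4 , 7) ∷ (2 , 4) ∷ (2 , 9) ∷ (2 , 8) ∷ (0 , 7) ∷ (2 , 7) ∷ (6 , 9) ∷ (7 , 8) ∷ (2 , 11) ∷
  (5 , 7) ∷ (8 , 9) ∷ (0 , 10) ∷ (5 , 10) ∷ (3 , 10) ∷ (0 , 11) ∷ (0 , 2) ∷ (0 , 1) ∷ (1 , 2) ∷ (9 , 11) ∷
  (1 , 7) ∷ (10 , 11) ∷ (7 , 10) ∷ (1 , 8) ∷
  []

blocks₅ : WeightedBlocks 15
blocks₅ =
  (15 , triple 0 1 2) ∷ (7 , triple 0 1 3) ∷ (2 , triple 0 1 4) ∷ (16 , triple 0 1 7) ∷ (2 , triple 0 1 8) ∷ (6 , triple 0 1 9) ∷
  (6 , triple 0 1 13) ∷ (4 , triple 0 2 3) ∷ (24 , triple 0 2 4) ∷ (3 , triple 0 2 8) ∷ (2 , triple 0 2 9) ∷ (8 , triple 0 2 11) ∷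
  (3 , triple 0 2 13) ∷ (1 , triple 0 2 14) ∷ (10 , triple 0 3 4) ∷ (2 , triple 0 3 6) ∷ (1 , triple 0 3 7) ∷ (10 , triple 0 3 11) ∷
  (1 , triple 0 3 12) ∷ (5 , triple 0 4 7) ∷ (4 , triple 0 4 8) ∷ (18 , triple 0 4 11) ∷ (2 , triple 0 4 13) ∷ (1 , triple 0 6 9) ∷
  (1 , triple 0 6 13) ∷ (1 , triple 0 6 14) ∷ (8 , triple 0 7 8) ∷ (1 , triple 0 7 9) ∷ (7 , triple 0 7 11) ∷ (2 , triple 0 7 14) ∷
  (15 , triple 0 8 9) ∷ (9 , triple 0 8 11) ∷ (5 , triple 0 8 14) ∷ (7 , triple 0 9 11) ∷ (6 , triple 0 9 13) ∷ (3 , triple 0 11 14) ∷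
  (2 , triple 0 12 13) ∷ (2 , triple 0 13 14) ∷ (4 , triple 1 2 3) ∷ (19 , triple 1 2 4) ∷ (3 , triple 1 2 5) ∷ (4 , triple 1 2 8) ∷
  (8 , triple 1 2 9) ∷ (15 , triple 1 2 10) ∷ (1 , triple 1 2 13) ∷ (1 , triple 1 2 14) ∷ (25 , triple 1 3 4) ∷ (13 , triple 1 3 5) ∷
  (1 , triple 1 3 7) ∷ (1 , triple 1 3 12) ∷ (4 , triple 1 4 5) ∷ (11 , triple 1 4 7) ∷ (5 , triple 1 4 10) ∷ (8 , triple 1 5 7) ∷
  (5 , triple 1 5 8) ∷ (2 , triple 1 5 9) ∷ (5 , triple 1 5 12) ∷ (14 , triple 1 5 13) ∷ (3 , triple 1 5 14) ∷ (2 , triple 1 7 8) ∷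
  (1 , triple 1 7 9) ∷ (10 , triple 1 7 10) ∷ (2 , triple 1 7 13) ∷ (4 , triple 1 7 14) ∷ (2 , triple 1 8 9) ∷ (5 , triple 1 8 10) ∷
  (1 , triple 1 8 14) ∷ (1 , triple 1 9 12) ∷ (1 , triple 1 10 12) ∷ (7 , triple 1 10 13) ∷ (6 , triple 1 10 14) ∷ (2 , triple 1 12 13) ∷
  (8 , triple 2 3 4) ∷ (4 , triple 2 3 5) ∷ (2 , triple 2 3 6) ∷ (1 , triple 2 3 9) ∷ (8 , triple 2 3 10) ∷ (21 , triple 2 3 11) ∷
  (6 , triple 2 4 5) ∷ (14 , triple 2 4 8) ∷ (10 , triple 2 4 10) ∷ (1 , triple 2 4 11) ∷ (4 , triple 2 5 6) ∷ (8 , triple 2 5 8) ∷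
  (19 , triple 2 5 9) ∷ (12 , triple 2 5 11) ∷ (2 , triple 2 5 13) ∷ (1 , triple 2 6 8) ∷ (1 , triple 2 6 9) ∷ (5 , triple 2 6 10) ∷
  (9 , triple 2 6 13) ∷ (4 , triple 2 6 14) ∷ (3 , triple 2 8 10) ∷ (8 , triple 2 8 11) ∷ (2 , triple 2 8 14) ∷ (11 , triple 2 9 10) ∷
  (9 , triple 2 9 11) ∷ (8 , triple 2 9 13) ∷ (12 , triple 2 10 11) ∷ (3 , triple 2 10 13) ∷ (7 , triple 2 10 14) ∷ (8 , triple 2 11 14) ∷
  (2 , triple 2 13 14) ∷ (1 , triple 3 4 5) ∷ (2 , triple 3 4 6) ∷ (25 , triple 3 4 7) ∷ (10 , triple 3 4 10) ∷ (7 , triple 3 4 11) ∷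
  (10 , triple 3 5 6) ∷ (22 , triple 3 5 7) ∷ (1 , triple 3 5 9) ∷ (11 , triple 3 5 11) ∷ (2 , triple 3 5 12) ∷ (1 , triple 3 6 9) ∷
  (11 , triple 3 6 10) ∷ (1 , triple 3 6 12) ∷ (16 , triple 3 6 14) ∷ (3 , triple 3 7 9) ∷ (3 , triple 3 7 10) ∷ (8 , triple 3 7 14) ∷
  (7 , triple 3 9 10) ∷ (10 , triple 3 9 11) ∷ (3 , triple 3 10 11) ∷ (5 , triple 3 10 14) ∷ (1 , triple 3 11 12) ∷ (10 , triple 3 11 14) ∷
  (2 , triple 3 12 14) ∷ (3 , triple 4 5 6) ∷ (8 , triple 4 5 7) ∷ (5 , triple 4 5 8) ∷ (1 , triple 4 5 11) ∷ (1 , triple 4 5 13) ∷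
  (1 , triple 4 6 8) ∷ (9 , triple 4 6 10) ∷ (2 , triple 4 6 13) ∷ (28 , triple 4 7 8) ∷ (2 , triple 4 7 10) ∷ (5 , triple 4 7 11) ∷
  (9 , triple 4 8 10) ∷ (10 , triple 4 10 11) ∷ (1 , triple 4 10 13) ∷ (9 , triple 5 6 7) ∷ (20 , triple 5 6 8) ∷ (8 , triple 5 6 9) ∷
  (22 , triple 5 6 14) ∷ (1 , triple 5 7 8) ∷ (22 , triple 5 7 9) ∷ (15 , triple 5 7 11) ∷ (2 , triple 5 7 13) ∷ (1 , triple 5 8 9) ∷
  (2 , triple 5 8 11) ∷ (8 , triple 5 8 14) ∷ (19 , triple 5 9 11) ∷ (5 , triple 5 9 13) ∷ (5 , triple 5 11 13) ∷ (2 , triple 5 11 14) ∷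
  (4 , triple 5 12 13) ∷ (1 , triple 5 12 14) ∷ (1 , triple 5 13 14) ∷ (12 , triple 6 7 8) ∷ (37 , triple 6 7 10) ∷ (1 , triple 6 7 13) ∷
  (21 , triple 6 7 14) ∷ (12 , triple 6 8 10) ∷ (1 , triple 6 8 12) ∷ (6 , triple 6 8 14) ∷ (2 , triple 6 9 10) ∷ (11 , triple 6 9 13) ∷
  (4 , triple 6 10 13) ∷ (5 , triple 6 10 14) ∷ (1 , triple 6 12 13) ∷ (1 , triple 6 12 14) ∷ (2 , triple 6 13 14) ∷ (7 , triple 7 8 9) ∷
  (9 , triple 7 8 10) ∷ (10 , triple 7 8 11) ∷ (6 , triple 7 8 14) ∷ (4 , triple 7 9 10) ∷ (8 , triple 7 9 11) ∷ (2 , triple 7 9 13) ∷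
  (2 , triple 7 10 13) ∷ (1 , triple 7 10 14) ∷ (7 , triple 7 11 13) ∷ (37 , triple 7 11 14) ∷ (2 , triple 7 13 14) ∷ (2 , triple 8 9 10) ∷
  (12 , triple 8 9 11) ∷ (29 , triple 8 10 11) ∷ (2 , triple 8 11 14) ∷ (9 , triple 9 10 11) ∷ (1 , triple 9 10 13) ∷ (1 , triple 9 11 12) ∷
  (11 , triple 9 11 13) ∷ (3 , triple 10 11 12) ∷ (5 , triple 10 11 14) ∷ (3 , triple 10 12 14) ∷ (1 , triple 10 13 14) ∷ (4 , triple 11 12 14) ∷
  (4 , triple 11 13 14) ∷ (2 , triple 12 13 14) ∷
  []

pairsByFreq₅ : List (ℕ × ℕ)
pairsByFreq₅ =
  (4 , 12) ∷ (8 , 12) ∷ (9 , 12) ∷ (0 , 12) ∷ (6 , 12) ∷ (0 , 6) ∷ (4 , 13) ∷ (10 , 12) ∷ (3 , 12) ∷ (11 , 12) ∷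
  (1 , 12) ∷ (12 , 13) ∷ (5 , 12) ∷ (12 , 14) ∷ (0 , 14) ∷ (1 , 14) ∷ (13 , 14) ∷ (4 , 6) ∷ (7 , 13) ∷ (10 , 13) ∷
  (1 , 9) ∷ (1 , 8) ∷ (0 , 13) ∷ (3 , 9) ∷ (6 , 9) ∷ (2 , 14) ∷ (2 , 6) ∷ (11 , 13) ∷ (2 , 13) ∷ (4 , 5) ∷
  (8 , 14) ∷ (6 , 13) ∷ (1 , 13) ∷ (10 , 14) ∷ (5 , 13) ∷ (0 , 3) ∷ (9 , 10) ∷ (5 , 14) ∷ (0 , 9) ∷ (8 , 9) ∷
  (0 , 7) ∷ (3 , 14) ∷ (4 , 11) ∷ (2 , 8) ∷ (9 , 13) ∷ (3 , 6) ∷ (0 , 8) ∷ (3 , 10) ∷ (7 , 9) ∷ (1 , 10) ∷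
  (5 , 8) ∷ (1 , 3) ∷ (2 , 3) ∷ (6 , 8) ∷ (0 , 1) ∷ (1 , 7) ∷ (4 , 10) ∷ (1 , 5) ∷ (2 , 5) ∷ (2 , 9) ∷
  (0 , 2) ∷ (4 , 8) ∷ (0 , 11) ∷ (3 , 7) ∷ (3 , 5) ∷ (0 , 4) ∷ (1 , 4) ∷ (5 , 11) ∷ (7 , 10) ∷ (8 , 10) ∷
  (1 , 2) ∷ (10 , 11) ∷ (8 , 11) ∷ (3 , 11) ∷ (2 , 10) ∷ (11 , 14) ∷ (5 , 6) ∷ (5 , 9) ∷ (6 , 14) ∷ (2 , 11) ∷
  (6 , 7) ∷ (7 , 14) ∷ (2 , 4) ∷ (7 , 8) ∷ (4 , 7) ∷ (6 , 10) ∷ (9 , 11) ∷ (5 , 7) ∷ (3 , 4) ∷ (7 , 11) ∷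
  []

blocks₈ : WeightedBlocks 24
blocks₈ =
  (1 , triple 0 1 2) ∷ (2 , triple 0 1 3) ∷ (1 , triple 0 1 5) ∷ (7 , triple 0 1 6) ∷ (1 , triple 0 1 7) ∷ (2 , triple 0 1 10) ∷
  (1 , triple 0 1 12) ∷ (7 , triple 0 1 14) ∷ (3 , triple 0 1 15) ∷ (4 , triple 0 1 18) ∷ (4 , triple 0 1 19) ∷ (3 , triple 0 1 20) ∷
  (1 , triple 0 1 21) ∷ (7 , triple 0 1 23) ∷ (6 , triple 0 2 3) ∷ (2 , triple 0 2 4) ∷ (4 , triple 0 2 5) ∷ (1 , triple 0 2 6) ∷
  (13 , triple 0 2 7) ∷ (15 , triple 0 2 9) ∷ (1 , triple 0 2 11) ∷ (1 , triple 0 2 12) ∷ (4 , triple 0 2 13) ∷ (8 , triple 0 2 15) ∷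
  (13 , triple 0 2 17) ∷ (3 , triple 0 2 19) ∷ (4 , triple 0 2 20) ∷ (2 , triple 0 2 21) ∷ (6 , triple 0 2 23) ∷ (4 , triple 0 3 4) ∷
  (15 , triple 0 3 5) ∷ (18 , triple 0 3 6) ∷ (5 , triple 0 3 7) ∷ (10 , triple 0 3 9) ∷ (1 , triple 0 3 10) ∷ (2 , triple 0 3 14) ∷
  (5 , triple 0 3 15) ∷ (22 , triple 0 3 18) ∷ (3 , triple 0 3 20) ∷ (1 , triple 0 3 21) ∷ (10 , triple 0 3 22) ∷ (23 , triple 0 3 23) ∷
  (9 , triple 0 4 5) ∷ (1 , triple 0 4 6) ∷ (2 , triple 0 4 7) ∷ (19 , triple 0 4 9) ∷ (16 , triple 0 4 10) ∷ (3 , triple 0 4 14) ∷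
  (8 , triple 0 4 15) ∷ (2 , triple 0 4 17) ∷ (19 , triple 0 4 18) ∷ (5 , triple 0 4 19) ∷ (9 , triple 0 4 21) ∷ (1 , triple 0 4 22) ∷
  (7 , triple 0 4 23) ∷ (26 , triple 0 5 6) ∷ (6 , triple 0 5 9) ∷ (7 , triple 0 5 10) ∷ (9 , triple 0 5 12) ∷ (1 , triple 0 5 14) ∷
  (1 , triple 0 5 15) ∷ (66 , triple 0 5 17) ∷ (11 , triple 0 5 18) ∷ (8 , triple 0 5 19) ∷ (2 , triple 0 5 20) ∷ (19 , triple 0 5 23) ∷
  (2 , triple 0 6 7) ∷ (16 , triple 0 6 9) ∷ (10 , triple 0 6 10) ∷ (1 , triple 0 6 12) ∷ (7 , triple 0 6 13) ∷ (25 , triple 0 6 15) ∷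
  (34 , triple 0 6 18) ∷ (11 , triple 0 6 19) ∷ (5 , triple 0 6 20) ∷ (18 , triple 0 6 21) ∷ (48 , triple 0 6 23) ∷ (6 , triple 0 7 9) ∷
  (1 , triple 0 7 10) ∷ (4 , triple 0 7 12) ∷ (1 , triple 0 7 14) ∷ (1 , triple 0 7 17) ∷ (2 , triple 0 7 18) ∷ (5 , triple 0 7 19) ∷
  (6 , triple 0 7 20) ∷ (3 , triple 0 7 21) ∷ (3 , triple 0 7 22) ∷ (1 , triple 0 9 10) ∷ (2 , triple 0 9 12) ∷ (2 , triple 0 9 14) ∷
  (1 , triple 0 9 15) ∷ (26 , triple 0 9 18) ∷ (6 , triple 0 9 20) ∷ (21 , triple 0 9 21) ∷ (1 , triple 0 9 22) ∷ (16 , triple 0 9 23) ∷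
  (7 , triple 0 10 12) ∷ (5 , triple 0 10 14) ∷ (1 , triple 0 10 15) ∷ (2 , triple 0 10 17) ∷ (1 , triple 0 10 21) ∷ (1 , triple 0 10 22) ∷
  (4 , triple 0 10 23) ∷ (1 , triple 0 11 13) ∷ (1 , triple 0 11 18) ∷ (5 , triple 0 12 15) ∷ (14 , triple 0 12 17) ∷ (1 , triple 0 12 18) ∷
  (12 , triple 0 12 19) ∷ (3 , triple 0 12 22) ∷ (7 , triple 0 12 23) ∷ (3 , triple 0 13 15) ∷ (3 , triple 0 13 17) ∷ (1 , triple 0 13 18) ∷
  (5 , triple 0 13 20) ∷ (3 , triple 0 13 23) ∷ (2 , triple 0 14 15) ∷ (6 , triple 0 14 17) ∷ (2 , triple 0 14 18) ∷ (6 , triple 0 14 19) ∷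
  (2 , triple 0 14 20) ∷ (1 , triple 0 14 23) ∷ (4 , triple 0 15 17) ∷ (15 , triple 0 15 18) ∷ (24 , triple 0 15 19) ∷ (3 , triple 0 15 20) ∷
  (7 , triple 0 15 21) ∷ (24 , triple 0 17 18) ∷ (7 , triple 0 17 19) ∷ (1 , triple 0 17 20) ∷ (18 , triple 0 17 21) ∷ (65 , triple 0 17 22) ∷
  (3 , triple 0 17 23) ∷ (25 , triple 0 18 19) ∷ (1 , triple 0 18 20) ∷ (1 , triple 0 18 22) ∷ (14 , triple 0 18 23) ∷ (14 , triple 0 19 20) ∷
  (19 , triple 0 19 21) ∷ (5 , triple 0 19 22) ∷ (12 , triple 0 19 23) ∷ (2 , triple 0 20 21) ∷ (11 , triple 0 20 23) ∷ (40 , triple 0 21 22) ∷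
  (11 , triple 0 21 23) ∷ (5 , triple 0 22 23) ∷ (15 , triple 1 2 3) ∷ (15 , triple 1 2 4) ∷ (7 , triple 1 2 5) ∷ (15 , triple 1 2 7) ∷
  (31 , triple 1 2 8) ∷ (38 , triple 1 2 12) ∷ (1 , triple 1 2 15) ∷ (2 , triple 1 2 16) ∷ (26 , triple 1 2 19) ∷ (1 , triple 1 2 20) ∷
  (1 , triple 1 2 21) ∷ (6 , triple 1 2 22) ∷ (2 , triple 1 2 23) ∷ (1 , triple 1 3 4) ∷ (2 , triple 1 3 5) ∷ (13 , triple 1 3 6) ∷
  (19 , triple 1 3 7) ∷ (18 , triple 1 3 8) ∷ (4 , triple 1 3 10) ∷ (4 , triple 1 3 12) ∷ (1 , triple 1 3 13) ∷ (10 , triple 1 3 14) ∷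
  (2 , triple 1 3 15) ∷ (15 , triple 1 3 16) ∷ (35 , triple 1 3 18) ∷ (27 , triple 1 3 20) ∷ (18 , triple 1 3 21) ∷ (2 , triple 1 3 22) ∷
  (14 , triple 1 3 23) ∷ (3 , triple 1 4 5) ∷ (19 , triple 1 4 6) ∷ (3 , triple 1 4 8) ∷ (17 , triple 1 4 10) ∷ (1 , triple 1 4 13) ∷
  (3 , triple 1 4 14) ∷ (10 , triple 1 4 15) ∷ (3 , triple 1 4 16) ∷ (57 , triple 1 4 18) ∷ (12 , triple 1 4 19) ∷ (5 , triple 1 4 21) ∷
  (10 , triple 1 4 22) ∷ (8 , triple 1 4 23) ∷ (31 , triple 1 5 6) ∷ (7 , triple 1 5 7) ∷ (18 , triple 1 5 8) ∷ (11 , triple 1 5 10) ∷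
  (1 , triple 1 5 11) ∷ (9 , triple 1 5 14) ∷ (3 , triple 1 5 15) ∷ (51 , triple 1 5 16) ∷ (5 , triple 1 5 18) ∷ (2 , triple 1 5 19) ∷
  (24 , triple 1 5 20) ∷ (38 , triple 1 5 22) ∷ (9 , triple 1 5 23) ∷ (5 , triple 1 6 7) ∷ (5 , triple 1 6 8) ∷ (6 , triple 1 6 10) ∷
  (3 , triple 1 6 11) ∷ (5 , triple 1 6 12) ∷ (1 , triple 1 6 13) ∷ (27 , triple 1 6 15) ∷ (8 , triple 1 6 18) ∷ (20 , triple 1 6 19) ∷
  (20 , triple 1 6 20) ∷ (2 , triple 1 6 21) ∷ (24 , triple 1 6 23) ∷ (3 , triple 1 7 8) ∷ (1 , triple 1 7 10) ∷ (2 , triple 1 7 12) ∷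
  (10 , triple 1 7 14) ∷ (9 , triple 1 7 16) ∷ (10 , triple 1 7 18) ∷ (5 , triple 1 7 19) ∷ (14 , triple 1 7 20) ∷ (1 , triple 1 7 22) ∷
  (17 , triple 1 8 10) ∷ (23 , triple 1 8 12) ∷ (2 , triple 1 8 13) ∷ (4 , triple 1 8 14) ∷ (2 , triple 1 8 18) ∷ (21 , triple 1 8 20) ∷
  (3 , triple 1 8 21) ∷ (2 , triple 1 8 22) ∷ (12 , triple 1 8 23) ∷ (2 , triple 1 10 15) ∷ (6 , triple 1 10 16) ∷ (32 , triple 1 10 20) ∷
  (7 , triple 1 10 21) ∷ (4 , triple 1 10 22) ∷ (7 , triple 1 10 23) ∷ (1 , triple 1 11 22) ∷ (1 , triple 1 11 23) ∷ (1 , triple 1 12 13) ∷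
  (2 , triple 1 12 14) ∷ (1 , triple 1 12 15) ∷ (1 , triple 1 12 16) ∷ (1 , triple 1 12 18) ∷ (7 , triple 1 12 19) ∷ (2 , triple 1 12 21) ∷
  (2 , triple 1 12 22) ∷ (4 , triple 1 12 23) ∷ (1 , triple 1 13 15) ∷ (2 , triple 1 13 16) ∷ (1 , triple 1 13 20) ∷ (1 , triple 1 13 23) ∷
  (13 , triple 1 14 15) ∷ (3 , triple 1 14 16) ∷ (3 , triple 1 14 18) ∷ (8 , triple 1 14 19) ∷ (12 , triple 1 14 20) ∷ (9 , triple 1 14 21) ∷
  (6 , triple 1 14 23) ∷ (3 , triple 1 15 16) ∷ (6 , triple 1 15 18) ∷ (10 , triple 1 15 20) ∷ (7 , triple 1 15 21) ∷ (3 , triple 1 15 22) ∷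
  (5 , triple 1 16 18) ∷ (54 , triple 1 16 19) ∷ (15 , triple 1 16 20) ∷ (4 , triple 1 16 21) ∷ (17 , triple 1 16 23) ∷ (25 , triple 1 18 19) ∷
  (24 , triple 1 18 20) ∷ (5 , triple 1 18 21) ∷ (7 , triple 1 18 22) ∷ (12 , triple 1 18 23) ∷ (4 , triple 1 19 21) ∷ (4 , triple 1 19 22) ∷
  (5 , triple 1 19 23) ∷ (1 , triple 1 20 21) ∷ (6 , triple 1 20 22) ∷ (12 , triple 1 20 23) ∷ (4 , triple 1 21 22) ∷ (5 , triple 1 22 23) ∷
  (27 , triple 2 3 4) ∷ (8 , triple 2 3 5) ∷ (6 , triple 2 3 6) ∷ (6 , triple 2 3 7) ∷ (8 , triple 2 3 9) ∷ (2 , triple 2 3 12) ∷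
  (2 , triple 2 3 13) ∷ (8 , triple 2 3 14) ∷ (3 , triple 2 3 15) ∷ (6 , triple 2 3 16) ∷ (11 , triple 2 3 23) ∷ (1 , triple 2 4 5) ∷
  (3 , triple 2 4 6) ∷ (8 , triple 2 4 7) ∷ (32 , triple 2 4 8) ∷ (1 , triple 2 4 9) ∷ (3 , triple 2 4 11) ∷ (1 , triple 2 4 13) ∷
  (4 , triple 2 4 14) ∷ (1 , triple 2 4 15) ∷ (8 , triple 2 4 16) ∷ (18 , triple 2 4 17) ∷ (6 , triple 2 4 19) ∷ (20 , triple 2 4 21) ∷
  (5 , triple 2 4 22) ∷ (2 , triple 2 4 23) ∷ (9 , triple 2 5 6) ∷ (6 , triple 2 5 7) ∷ (12 , triple 2 5 8) ∷ (2 , triple 2 5 9) ∷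
  (8 , triple 2 5 12) ∷ (3 , triple 2 5 15) ∷ (2 , triple 2 5 16) ∷ (10 , triple 2 5 17) ∷ (1 , triple 2 5 19) ∷ (5 , triple 2 5 20) ∷
  (1 , triple 2 5 22) ∷ (6 , triple 2 5 23) ∷ (8 , triple 2 6 7) ∷ (3 , triple 2 6 8) ∷ (13 , triple 2 6 9) ∷ (1 , triple 2 6 11) ∷
  (9 , triple 2 6 12) ∷ (3 , triple 2 6 13) ∷ (3 , triple 2 6 15) ∷ (7 , triple 2 6 16) ∷ (2 , triple 2 6 19) ∷ (1 , triple 2 6 20) ∷
  (4 , triple 2 6 21) ∷ (7 , triple 2 6 23) ∷ (3 , triple 2 7 8) ∷ (5 , triple 2 7 9) ∷ (1 , triple 2 7 11) ∷ (3 , triple 2 7 13) ∷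
  (5 , triple 2 7 14) ∷ (10 , triple 2 7 16) ∷ (26 , triple 2 7 17) ∷ (6 , triple 2 7 19) ∷ (3 , triple 2 7 20) ∷ (8 , triple 2 7 21) ∷
  (64 , triple 2 8 9) ∷ (1 , triple 2 8 13) ∷ (1 , triple 2 8 14) ∷ (4 , triple 2 8 15) ∷ (5 , triple 2 8 17) ∷ (1 , triple 2 8 19) ∷
  (3 , triple 2 8 20) ∷ (47 , triple 2 8 21) ∷ (4 , triple 2 8 22) ∷ (3 , triple 2 8 23) ∷ (15 , triple 2 9 12) ∷ (8 , triple 2 9 14) ∷
  (9 , triple 2 9 15) ∷ (12 , triple 2 9 16) ∷ (8 , triple 2 9 19) ∷ (6 , triple 2 9 20) ∷ (9 , triple 2 9 21) ∷ (9 , triple 2 9 23) ∷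
  (2 , triple 2 11 14) ∷ (1 , triple 2 11 15) ∷ (8 , triple 2 12 14) ∷ (7 , triple 2 12 15) ∷ (59 , triple 2 12 16) ∷ (16 , triple 2 12 17) ∷
  (26 , triple 2 12 19) ∷ (1 , triple 2 12 21) ∷ (1 , triple 2 12 22) ∷ (37 , triple 2 12 23) ∷ (1 , triple 2 13 14) ∷ (1 , triple 2 13 15) ∷
  (3 , triple 2 13 16) ∷ (5 , triple 2 13 17) ∷ (3 , triple 2 13 19) ∷ (3 , triple 2 13 20) ∷ (4 , triple 2 13 23) ∷ (3 , triple 2 14 15) ∷
  (3 , triple 2 14 16) ∷ (6 , triple 2 14 17) ∷ (1 , triple 2 14 20) ∷ (2 , triple 2 14 23) ∷ (9 , triple 2 15 16) ∷ (17 , triple 2 15 17) ∷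
  (9 , triple 2 15 19) ∷ (1 , triple 2 15 20) ∷ (6 , triple 2 15 22) ∷ (7 , triple 2 16 17) ∷ (2 , triple 2 16 19) ∷ (19 , triple 2 16 20) ∷
  (12 , triple 2 16 21) ∷ (5 , triple 2 16 23) ∷ (34 , triple 2 17 19) ∷ (6 , triple 2 17 20) ∷ (40 , triple 2 17 21) ∷ (8 , triple 2 17 22) ∷
  (6 , triple 2 17 23) ∷ (6 , triple 2 19 20) ∷ (21 , triple 2 19 21) ∷ (9 , triple 2 19 22) ∷ (2 , triple 2 19 23) ∷ (1 , triple 2 20 22) ∷
  (6 , triple 2 21 22) ∷ (16 , triple 2 21 23) ∷ (1 , triple 2 22 23) ∷ (10 , triple 3 4 5) ∷ (9 , triple 3 4 6) ∷ (15 , triple 3 4 7) ∷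
  (11 , triple 3 4 8) ∷ (3 , triple 3 4 9) ∷ (3 , triple 3 4 13) ∷ (3 , triple 3 4 14) ∷ (6 , triple 3 4 15) ∷ (4 , triple 3 4 16) ∷
  (2 , triple 3 4 17) ∷ (14 , triple 3 4 18) ∷ (18 , triple 3 4 21) ∷ (22 , triple 3 4 22) ∷ (7 , triple 3 4 23) ∷ (9 , triple 3 5 6) ∷
  (52 , triple 3 5 7) ∷ (2 , triple 3 5 8) ∷ (31 , triple 3 5 9) ∷ (4 , triple 3 5 10) ∷ (2 , triple 3 5 14) ∷ (3 , triple 3 5 16) ∷
  (4 , triple 3 5 17) ∷ (26 , triple 3 5 18) ∷ (9 , triple 3 5 20) ∷ (34 , triple 3 5 23) ∷ (15 , triple 3 6 7) ∷ (11 , triple 3 6 8) ∷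
  (18 , triple 3 6 9) ∷ (2 , triple 3 6 12) ∷ (1 , triple 3 6 13) ∷ (16 , triple 3 6 15) ∷ (9 , triple 3 6 16) ∷ (4 , triple 3 6 17) ∷
  (2 , triple 3 6 18) ∷ (10 , triple 3 6 20) ∷ (40 , triple 3 6 21) ∷ (5 , triple 3 6 23) ∷ (10 , triple 3 7 8) ∷ (4 , triple 3 7 9) ∷
  (14 , triple 3 7 10) ∷ (3 , triple 3 7 12) ∷ (2 , triple 3 7 13) ∷ (6 , triple 3 7 14) ∷ (2 , triple 3 7 16) ∷ (17 , triple 3 7 17) ∷
  (13 , triple 3 7 18) ∷ (10 , triple 3 7 20) ∷ (1 , triple 3 7 21) ∷ (12 , triple 3 7 22) ∷ (1 , triple 3 8 10) ∷ (5 , triple 3 8 12) ∷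
  (2 , triple 3 8 13) ∷ (3 , triple 3 8 17) ∷ (1 , triple 3 8 18) ∷ (3 , triple 3 8 20) ∷ (7 , triple 3 8 21) ∷ (2 , triple 3 8 22) ∷
  (5 , triple 3 8 23) ∷ (8 , triple 3 9 10) ∷ (7 , triple 3 9 12) ∷ (2 , triple 3 9 13) ∷ (29 , triple 3 9 16) ∷ (18 , triple 3 9 18) ∷
  (1 , triple 3 9 21) ∷ (7 , triple 3 9 22) ∷ (35 , triple 3 9 23) ∷ (8 , triple 3 10 12) ∷ (7 , triple 3 10 15) ∷ (7 , triple 3 10 16) ∷
  (7 , triple 3 10 17) ∷ (3 , triple 3 10 20) ∷ (1 , triple 3 10 21) ∷ (13 , triple 3 10 23) ∷ (1 , triple 3 12 13) ∷ (1 , triple 3 12 14) ∷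
  (4 , triple 3 12 15) ∷ (15 , triple 3 12 16) ∷ (22 , triple 3 12 17) ∷ (6 , triple 3 12 18) ∷ (1 , triple 3 12 21) ∷ (9 , triple 3 12 23) ∷
  (2 , triple 3 13 14) ∷ (3 , triple 3 13 15) ∷ (1 , triple 3 13 16) ∷ (1 , triple 3 13 18) ∷ (11 , triple 3 13 20) ∷ (1 , triple 3 13 23) ∷
  (2 , triple 3 14 15) ∷ (11 , triple 3 14 17) ∷ (10 , triple 3 14 18) ∷ (5 , triple 3 14 20) ∷ (2 , triple 3 14 21) ∷ (5 , triple 3 14 23) ∷
  (9 , triple 3 15 16) ∷ (2 , triple 3 15 18) ∷ (4 , triple 3 15 21) ∷ (7 , triple 3 15 22) ∷ (8 , triple 3 16 17) ∷ (4 , triple 3 16 18) ∷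
  (2 , triple 3 16 20) ∷ (6 , triple 3 16 21) ∷ (1 , triple 3 16 22) ∷ (22 , triple 3 16 23) ∷ (3 , triple 3 17 18) ∷ (39 , triple 3 17 20) ∷
  (11 , triple 3 17 21) ∷ (53 , triple 3 17 22) ∷ (17 , triple 3 17 23) ∷ (36 , triple 3 18 20) ∷ (34 , triple 3 18 21) ∷ (9 , triple 3 18 22) ∷
  (8 , triple 3 18 23) ∷ (3 , triple 3 20 22) ∷ (7 , triple 3 20 23) ∷ (12 , triple 3 21 22) ∷ (13 , triple 3 21 23) ∷ (2 , triple 3 22 23) ∷
  (1 , triple 4 5 6) ∷ (6 , triple 4 5 7) ∷ (7 , triple 4 5 8) ∷ (39 , triple 4 5 9) ∷ (2 , triple 4 5 15) ∷ (50 , triple 4 5 16) ∷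
  (4 , triple 4 5 17) ∷ (7 , triple 4 5 18) ∷ (1 , triple 4 5 22) ∷ (23 , triple 4 5 23) ∷ (10 , triple 4 6 7) ∷ (23 , triple 4 6 8) ∷
  (16 , triple 4 6 9) ∷ (50 , triple 4 6 10) ∷ (2 , triple 4 6 11) ∷ (2 , triple 4 6 13) ∷ (2 , triple 4 6 15) ∷ (16 , triple 4 6 16) ∷
  (4 , triple 4 6 17) ∷ (26 , triple 4 6 18) ∷ (18 , triple 4 6 19) ∷ (7 , triple 4 6 21) ∷ (9 , triple 4 6 23) ∷ (1 , triple 4 7 8) ∷
  (4 , triple 4 7 9) ∷ (3 , triple 4 7 10) ∷ (1 , triple 4 7 14) ∷ (13 , triple 4 7 16) ∷ (6 , triple 4 7 17) ∷ (1 , triple 4 7 18) ∷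
  (1 , triple 4 7 19) ∷ (8 , triple 4 7 21) ∷ (4 , triple 4 7 22) ∷ (52 , triple 4 8 9) ∷ (10 , triple 4 8 10) ∷ (1 , triple 4 8 13) ∷
  (18 , triple 4 8 15) ∷ (2 , triple 4 8 19) ∷ (20 , triple 4 8 21) ∷ (2 , triple 4 8 22) ∷ (16 , triple 4 8 23) ∷ (3 , triple 4 9 10) ∷
  (1 , triple 4 9 11) ∷ (1 , triple 4 9 13) ∷ (6 , triple 4 9 14) ∷ (2 , triple 4 9 15) ∷ (29 , triple 4 9 16) ∷ (2 , triple 4 9 18) ∷
  (7 , triple 4 9 19) ∷ (2 , triple 4 9 21) ∷ (1 , triple 4 9 22) ∷ (37 , triple 4 9 23) ∷ (1 , triple 4 10 13) ∷ (3 , triple 4 10 14) ∷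
  (8 , triple 4 10 15) ∷ (32 , triple 4 10 16) ∷ (39 , triple 4 10 17) ∷ (5 , triple 4 10 19) ∷ (26 , triple 4 10 21) ∷ (12 , triple 4 10 22) ∷
  (1 , triple 4 10 23) ∷ (1 , triple 4 11 15) ∷ (2 , triple 4 11 17) ∷ (3 , triple 4 11 18) ∷ (1 , triple 4 11 22) ∷ (2 , triple 4 13 15) ∷
  (2 , triple 4 13 17) ∷ (3 , triple 4 13 18) ∷ (1 , triple 4 13 22) ∷ (5 , triple 4 13 23) ∷ (3 , triple 4 14 15) ∷ (4 , triple 4 14 16) ∷
  (10 , triple 4 14 17) ∷ (4 , triple 4 14 18) ∷ (4 , triple 4 14 19) ∷ (12 , triple 4 14 21) ∷ (1 , triple 4 14 23) ∷ (11 , triple 4 15 16) ∷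
  (4 , triple 4 15 17) ∷ (11 , triple 4 15 19) ∷ (4 , triple 4 15 21) ∷ (5 , triple 4 15 22) ∷ (14 , triple 4 16 17) ∷ (2 , triple 4 16 18) ∷
  (3 , triple 4 16 19) ∷ (24 , triple 4 16 21) ∷ (2 , triple 4 16 22) ∷ (17 , triple 4 16 23) ∷ (8 , triple 4 17 18) ∷ (18 , triple 4 17 19) ∷
  (16 , triple 4 17 21) ∷ (37 , triple 4 17 22) ∷ (18 , triple 4 17 23) ∷ (14 , triple 4 18 19) ∷ (18 , triple 4 18 21) ∷ (3 , triple 4 18 22) ∷
  (13 , triple 4 18 23) ∷ (8 , triple 4 19 21) ∷ (9 , triple 4 19 22) ∷ (2 , triple 4 19 23) ∷ (5 , triple 4 21 22) ∷ (38 , triple 4 21 23) ∷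
  (3 , triple 4 22 23) ∷ (18 , triple 5 6 7) ∷ (3 , triple 5 6 8) ∷ (20 , triple 5 6 9) ∷ (23 , triple 5 6 10) ∷ (15 , triple 5 6 12) ∷
  (11 , triple 5 6 15) ∷ (12 , triple 5 6 16) ∷ (3 , triple 5 6 17) ∷ (3 , triple 5 6 18) ∷ (13 , triple 5 6 19) ∷ (4 , triple 5 6 20) ∷
  (19 , triple 5 6 23) ∷ (2 , triple 5 7 8) ∷ (4 , triple 5 7 9) ∷ (8 , triple 5 7 10) ∷ (14 , triple 5 7 14) ∷ (10 , triple 5 7 16) ∷
  (4 , triple 5 7 17) ∷ (8 , triple 5 7 18) ∷ (1 , triple 5 7 19) ∷ (5 , triple 5 7 20) ∷ (10 , triple 5 8 9) ∷ (35 , triple 5 8 10) ∷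
  (7 , triple 5 8 12) ∷ (7 , triple 5 8 15) ∷ (5 , triple 5 8 17) ∷ (1 , triple 5 8 18) ∷ (15 , triple 5 8 19) ∷ (9 , triple 5 8 20) ∷
  (1 , triple 5 8 23) ∷ (4 , triple 5 9 10) ∷ (4 , triple 5 9 12) ∷ (1 , triple 5 9 14) ∷ (3 , triple 5 9 15) ∷ (16 , triple 5 9 16) ∷
  (45 , triple 5 9 18) ∷ (14 , triple 5 9 19) ∷ (1 , triple 5 9 20) ∷ (3 , triple 5 9 22) ∷ (33 , triple 5 9 23) ∷ (34 , triple 5 10 12) ∷
  (1 , triple 5 10 14) ∷ (9 , triple 5 10 15) ∷ (1 , triple 5 10 17) ∷ (8 , triple 5 10 19) ∷ (4 , triple 5 10 20) ∷ (11 , triple 5 10 22) ∷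
  (11 , triple 5 10 23) ∷ (2 , triple 5 11 12) ∷ (1 , triple 5 11 14) ∷ (1 , triple 5 11 23) ∷ (13 , triple 5 12 14) ∷ (44 , triple 5 12 16) ∷
  (28 , triple 5 12 17) ∷ (8 , triple 5 12 18) ∷ (1 , triple 5 12 22) ∷ (32 , triple 5 14 15) ∷ (2 , triple 5 14 16) ∷ (3 , triple 5 14 17) ∷
  (5 , triple 5 14 18) ∷ (34 , triple 5 14 20) ∷ (4 , triple 5 14 23) ∷ (9 , triple 5 15 16) ∷ (13 , triple 5 15 17) ∷ (2 , triple 5 15 18) ∷
  (7 , triple 5 15 19) ∷ (14 , triple 5 15 20) ∷ (4 , triple 5 15 22) ∷ (33 , triple 5 16 17) ∷ (2 , triple 5 16 18) ∷ (1 , triple 5 16 19) ∷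
  (4 , triple 5 16 20) ∷ (1 , triple 5 16 22) ∷ (3 , triple 5 16 23) ∷ (16 , triple 5 17 18) ∷ (22 , triple 5 17 19) ∷ (14 , triple 5 17 20) ∷
  (3 , triple 5 17 22) ∷ (10 , triple 5 17 23) ∷ (5 , triple 5 18 19) ∷ (47 , triple 5 18 20) ∷ (44 , triple 5 18 23) ∷ (22 , triple 5 19 20) ∷
  (11 , triple 5 19 22) ∷ (14 , triple 5 19 23) ∷ (3 , triple 5 20 22) ∷ (20 , triple 5 20 23) ∷ (5 , triple 6 7 8) ∷ (44 , triple 6 7 10) ∷
  (2 , triple 6 7 11) ∷ (6 , triple 6 7 12) ∷ (8 , triple 6 7 13) ∷ (4 , triple 6 7 16) ∷ (9 , triple 6 7 17) ∷ (41 , triple 6 7 18) ∷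
  (6 , triple 6 7 19) ∷ (19 , triple 6 7 20) ∷ (13 , triple 6 7 21) ∷ (18 , triple 6 8 9) ∷ (4 , triple 6 8 10) ∷ (14 , triple 6 8 12) ∷
  (2 , triple 6 8 13) ∷ (18 , triple 6 8 15) ∷ (13 , triple 6 8 17) ∷ (2 , triple 6 8 19) ∷ (9 , triple 6 8 20) ∷ (21 , triple 6 8 21) ∷
  (35 , triple 6 8 23) ∷ (16 , triple 6 9 10) ∷ (1 , triple 6 9 11) ∷ (7 , triple 6 9 12) ∷ (1 , triple 6 9 15) ∷ (10 , triple 6 9 16) ∷
  (5 , triple 6 9 18) ∷ (4 , triple 6 9 19) ∷ (8 , triple 6 9 20) ∷ (5 , triple 6 9 21) ∷ (17 , triple 6 9 23) ∷ (1 , triple 6 10 11) ∷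
  (2 , triple 6 10 12) ∷ (2 , triple 6 10 15) ∷ (10 , triple 6 10 16) ∷ (1 , triple 6 10 17) ∷ (4 , triple 6 10 19) ∷ (10 , triple 6 10 20) ∷
  (11 , triple 6 10 21) ∷ (14 , triple 6 10 23) ∷ (1 , triple 6 11 13) ∷ (1 , triple 6 11 15) ∷ (2 , triple 6 11 16) ∷ (1 , triple 6 11 17) ∷
  (2 , triple 6 11 18) ∷ (5 , triple 6 12 16) ∷ (1 , triple 6 12 17) ∷ (24 , triple 6 12 18) ∷ (9 , triple 6 12 19) ∷ (2 , triple 6 12 21) ∷
  (9 , triple 6 12 23) ∷ (2 , triple 6 13 15) ∷ (1 , triple 6 13 16) ∷ (3 , triple 6 13 17) ∷ (1 , triple 6 13 18) ∷ (3 , triple 6 13 19) ∷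
  (1 , triple 6 13 20) ∷ (7 , triple 6 13 23) ∷ (15 , triple 6 15 16) ∷ (18 , triple 6 15 17) ∷ (24 , triple 6 15 18) ∷ (14 , triple 6 15 19) ∷
  (2 , triple 6 15 20) ∷ (10 , triple 6 15 21) ∷ (2 , triple 6 16 17) ∷ (39 , triple 6 16 18) ∷ (46 , triple 6 16 19) ∷ (54 , triple 6 16 20) ∷
  (16 , triple 6 16 21) ∷ (1 , triple 6 16 23) ∷ (6 , triple 6 17 18) ∷ (27 , triple 6 17 19) ∷ (21 , triple 6 17 20) ∷ (9 , triple 6 17 21) ∷
  (1 , triple 6 17 23) ∷ (20 , triple 6 18 20) ∷ (6 , triple 6 18 23) ∷ (23 , triple 6 19 20) ∷ (31 , triple 6 19 21) ∷ (5 , triple 6 19 23) ∷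
  (8 , triple 6 20 21) ∷ (1 , triple 6 20 23) ∷ (37 , triple 6 21 23) ∷ (16 , triple 7 8 9) ∷ (3 , triple 7 8 10) ∷ (1 , triple 7 8 13) ∷
  (2 , triple 7 8 14) ∷ (1 , triple 7 8 17) ∷ (16 , triple 7 8 18) ∷ (6 , triple 7 8 19) ∷ (3 , triple 7 8 20) ∷ (16 , triple 7 8 21) ∷
  (21 , triple 7 9 10) ∷ (6 , triple 7 9 12) ∷ (2 , triple 7 9 13) ∷ (6 , triple 7 9 14) ∷ (1 , triple 7 9 18) ∷ (12 , triple 7 9 19) ∷
  (9 , triple 7 9 21) ∷ (18 , triple 7 9 22) ∷ (1 , triple 7 10 12) ∷ (1 , triple 7 10 13) ∷ (41 , triple 7 10 16) ∷ (2 , triple 7 10 17) ∷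
  (2 , triple 7 10 19) ∷ (17 , triple 7 10 20) ∷ (2 , triple 7 10 21) ∷ (21 , triple 7 10 22) ∷ (2 , triple 7 11 13) ∷ (1 , triple 7 11 14) ∷
  (1 , triple 7 11 16) ∷ (1 , triple 7 11 17) ∷ (2 , triple 7 11 22) ∷ (12 , triple 7 12 13) ∷ (2 , triple 7 12 14) ∷ (4 , triple 7 12 16) ∷
  (12 , triple 7 12 17) ∷ (2 , triple 7 12 18) ∷ (1 , triple 7 12 19) ∷ (9 , triple 7 12 22) ∷ (4 , triple 7 13 16) ∷ (7 , triple 7 13 20) ∷
  (3 , triple 7 13 22) ∷ (2 , triple 7 14 16) ∷ (3 , triple 7 14 17) ∷ (3 , triple 7 14 19) ∷ (4 , triple 7 14 20) ∷ (3 , triple 7 14 21) ∷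
  (3 , triple 7 16 17) ∷ (5 , triple 7 16 18) ∷ (16 , triple 7 16 20) ∷ (5 , triple 7 16 21) ∷ (10 , triple 7 16 22) ∷ (3 , triple 7 17 18) ∷
  (1 , triple 7 17 19) ∷ (26 , triple 7 17 20) ∷ (9 , triple 7 17 21) ∷ (28 , triple 7 17 22) ∷ (3 , triple 7 18 19) ∷ (7 , triple 7 18 21) ∷
  (5 , triple 7 19 20) ∷ (2 , triple 7 20 21) ∷ (3 , triple 7 20 22) ∷ (3 , triple 7 21 22) ∷ (22 , triple 8 9 10) ∷ (2 , triple 8 9 13) ∷
  (2 , triple 8 9 14) ∷ (7 , triple 8 9 15) ∷ (7 , triple 8 9 18) ∷ (3 , triple 8 9 19) ∷ (9 , triple 8 9 20) ∷ (3 , triple 8 9 22) ∷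
  (18 , triple 8 9 23) ∷ (7 , triple 8 10 14) ∷ (8 , triple 8 10 15) ∷ (5 , triple 8 10 17) ∷ (5 , triple 8 10 19) ∷ (6 , triple 8 10 20) ∷
  (17 , triple 8 10 21) ∷ (10 , triple 8 10 22) ∷ (30 , triple 8 10 23) ∷ (1 , triple 8 12 13) ∷ (4 , triple 8 12 14) ∷ (12 , triple 8 12 15) ∷
  (2 , triple 8 12 17) ∷ (3 , triple 8 12 18) ∷ (3 , triple 8 12 19) ∷ (3 , triple 8 12 21) ∷ (2 , triple 8 12 23) ∷ (2 , triple 8 13 14) ∷
  (2 , triple 8 13 15) ∷ (3 , triple 8 13 18) ∷ (5 , triple 8 13 19) ∷ (1 , triple 8 14 17) ∷ (6 , triple 8 14 19) ∷ (1 , triple 8 14 20) ∷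
  (6 , triple 8 15 17) ∷ (4 , triple 8 15 18) ∷ (1 , triple 8 15 21) ∷ (7 , triple 8 17 18) ∷ (1 , triple 8 17 19) ∷ (10 , triple 8 17 21) ∷
  (4 , triple 8 17 22) ∷ (11 , triple 8 17 23) ∷ (2 , triple 8 18 19) ∷ (3 , triple 8 18 20) ∷ (4 , triple 8 18 21) ∷ (3 , triple 8 18 22) ∷
  (3 , triple 8 19 20) ∷ (9 , triple 8 19 21) ∷ (12 , triple 8 19 23) ∷ (2 , triple 8 20 21) ∷ (2 , triple 8 21 23) ∷ (7 , triple 8 22 23) ∷
  (23 , triple 9 10 12) ∷ (11 , triple 9 10 15) ∷ (9 , triple 9 10 16) ∷ (15 , triple 9 10 19) ∷ (1 , triple 9 10 20) ∷ (6 , triple 9 10 21) ∷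
  (12 , triple 9 10 22) ∷ (4 , triple 9 10 23) ∷ (3 , triple 9 11 13) ∷ (1 , triple 9 11 15) ∷ (4 , triple 9 11 16) ∷ (2 , triple 9 11 22) ∷
  (19 , triple 9 12 15) ∷ (1 , triple 9 12 16) ∷ (6 , triple 9 12 18) ∷ (14 , triple 9 12 19) ∷ (14 , triple 9 12 21) ∷ (1 , triple 9 12 22) ∷
  (14 , triple 9 12 23) ∷ (3 , triple 9 13 14) ∷ (1 , triple 9 13 15) ∷ (2 , triple 9 13 20) ∷ (5 , triple 9 13 22) ∷ (2 , triple 9 14 15) ∷
  (4 , triple 9 14 16) ∷ (7 , triple 9 14 18) ∷ (1 , triple 9 14 19) ∷ (4 , triple 9 14 20) ∷ (20 , triple 9 15 16) ∷ (4 , triple 9 15 18) ∷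
  (12 , triple 9 15 19) ∷ (29 , triple 9 15 20) ∷ (12 , triple 9 15 21) ∷ (17 , triple 9 15 22) ∷ (5 , triple 9 16 18) ∷ (17 , triple 9 16 19) ∷
  (1 , triple 9 16 20) ∷ (3 , triple 9 16 21) ∷ (21 , triple 9 16 22) ∷ (12 , triple 9 16 23) ∷ (5 , triple 9 18 19) ∷ (8 , triple 9 18 20) ∷
  (27 , triple 9 18 21) ∷ (5 , triple 9 18 22) ∷ (3 , triple 9 18 23) ∷ (6 , triple 9 19 20) ∷ (21 , triple 9 19 21) ∷ (2 , triple 9 19 23) ∷
  (12 , triple 9 20 21) ∷ (4 , triple 9 20 22) ∷ (6 , triple 9 20 23) ∷ (3 , triple 9 21 22) ∷ (4 , triple 9 21 23) ∷ (2 , triple 9 22 23) ∷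
  (5 , triple 10 11 16) ∷ (1 , triple 10 11 17) ∷ (4 , triple 10 12 13) ∷ (6 , triple 10 12 14) ∷ (3 , triple 10 12 16) ∷ (27 , triple 10 12 17) ∷
  (3 , triple 10 12 21) ∷ (3 , triple 10 12 22) ∷ (7 , triple 10 12 23) ∷ (1 , triple 10 13 14) ∷ (1 , triple 10 13 16) ∷ (12 , triple 10 13 20) ∷
  (4 , triple 10 13 22) ∷ (4 , triple 10 13 23) ∷ (1 , triple 10 14 15) ∷ (11 , triple 10 14 16) ∷ (1 , triple 10 14 20) ∷ (5 , triple 10 14 21) ∷
  (1 , triple 10 14 23) ∷ (23 , triple 10 15 16) ∷ (6 , triple 10 15 17) ∷ (3 , triple 10 15 19) ∷ (19 , triple 10 15 21) ∷ (9 , triple 10 15 22) ∷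
  (30 , triple 10 16 17) ∷ (17 , triple 10 16 19) ∷ (12 , triple 10 16 20) ∷ (1 , triple 10 16 21) ∷ (4 , triple 10 16 22) ∷ (36 , triple 10 16 23) ∷
  (2 , triple 10 17 19) ∷ (29 , triple 10 17 20) ∷ (13 , triple 10 17 21) ∷ (11 , triple 10 17 22) ∷ (34 , triple 10 17 23) ∷ (2 , triple 10 19 21) ∷
  (1 , triple 10 19 22) ∷ (1 , triple 10 19 23) ∷ (2 , triple 10 20 23) ∷ (9 , triple 10 21 22) ∷ (8 , triple 10 21 23) ∷ (1 , triple 10 22 23) ∷
  (2 , triple 11 12 13) ∷ (2 , triple 11 12 14) ∷ (2 , triple 11 12 15) ∷ (7 , triple 11 12 16) ∷ (2 , triple 11 12 18) ∷ (3 , triple 11 12 22) ∷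
  (2 , triple 11 13 15) ∷ (3 , triple 11 13 16) ∷ (5 , triple 11 13 17) ∷ (2 , triple 11 14 16) ∷ (5 , triple 11 15 16) ∷ (1 , triple 11 15 17) ∷
  (1 , triple 11 15 18) ∷ (1 , triple 11 15 21) ∷ (2 , triple 11 16 17) ∷ (2 , triple 11 17 18) ∷ (1 , triple 11 17 20) ∷ (2 , triple 11 17 22) ∷
  (1 , triple 11 18 20) ∷ (2 , triple 11 18 22) ∷ (2 , triple 11 22 23) ∷ (1 , triple 12 13 15) ∷ (2 , triple 12 13 17) ∷ (5 , triple 12 13 18) ∷
  (5 , triple 12 13 19) ∷ (2 , triple 12 13 22) ∷ (3 , triple 12 14 15) ∷ (4 , triple 12 14 16) ∷ (4 , triple 12 14 17) ∷ (4 , triple 12 14 21) ∷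
  (1 , triple 12 14 23) ∷ (12 , triple 12 15 16) ∷ (4 , triple 12 15 17) ∷ (12 , triple 12 15 19) ∷ (13 , triple 12 15 21) ∷ (1 , triple 12 15 22) ∷
  (31 , triple 12 16 17) ∷ (9 , triple 12 16 18) ∷ (8 , triple 12 16 19) ∷ (7 , triple 12 16 21) ∷ (7 , triple 12 16 22) ∷ (29 , triple 12 16 23) ∷
  (16 , triple 12 17 18) ∷ (2 , triple 12 17 19) ∷ (2 , triple 12 17 22) ∷ (22 , triple 12 17 23) ∷ (4 , triple 12 18 19) ∷ (4 , triple 12 18 21) ∷
  (6 , triple 12 18 23) ∷ (1 , triple 12 19 21) ∷ (1 , triple 12 19 22) ∷ (31 , triple 12 19 23) ∷ (1 , triple 12 21 22) ∷ (10 , triple 12 21 23) ∷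
  (1 , triple 12 22 23) ∷ (1 , triple 13 14 15) ∷ (1 , triple 13 14 18) ∷ (9 , triple 13 14 20) ∷ (2 , triple 13 14 23) ∷ (4 , triple 13 15 16) ∷
  (9 , triple 13 15 17) ∷ (1 , triple 13 15 18) ∷ (2 , triple 13 15 19) ∷ (4 , triple 13 15 20) ∷ (4 , triple 13 16 17) ∷ (1 , triple 13 16 18) ∷
  (2 , triple 13 16 20) ∷ (3 , triple 13 16 22) ∷ (3 , triple 13 16 23) ∷ (2 , triple 13 17 18) ∷ (21 , triple 13 17 20) ∷ (3 , triple 13 17 22) ∷
  (3 , triple 13 17 23) ∷ (3 , triple 13 18 19) ∷ (3 , triple 13 18 20) ∷ (6 , triple 13 19 20) ∷ (6 , triple 13 19 22) ∷ (2 , triple 13 19 23) ∷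
  (4 , triple 13 20 23) ∷ (2 , triple 13 22 23) ∷ (38 , triple 14 15 17) ∷ (1 , triple 14 15 18) ∷ (1 , triple 14 15 19) ∷ (4 , triple 14 15 20) ∷
  (7 , triple 14 16 17) ∷ (3 , triple 14 16 18) ∷ (3 , triple 14 16 19) ∷ (10 , triple 14 16 20) ∷ (1 , triple 14 16 21) ∷ (12 , triple 14 16 23) ∷
  (15 , triple 14 17 19) ∷ (41 , triple 14 17 20) ∷ (7 , triple 14 17 21) ∷ (3 , triple 14 17 23) ∷ (2 , triple 14 18 19) ∷ (6 , triple 14 18 20) ∷
  (3 , triple 14 18 21) ∷ (4 , triple 14 18 23) ∷ (2 , triple 14 19 20) ∷ (1 , triple 14 19 21) ∷ (1 , triple 14 19 23) ∷ (1 , triple 14 20 23) ∷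
  (3 , triple 14 21 23) ∷ (6 , triple 15 16 17) ∷ (12 , triple 15 16 18) ∷ (7 , triple 15 16 19) ∷ (19 , triple 15 16 20) ∷ (1 , triple 15 16 21) ∷
  (4 , triple 15 16 22) ∷ (24 , triple 15 17 18) ∷ (1 , triple 15 17 19) ∷ (7 , triple 15 17 20) ∷ (13 , triple 15 17 21) ∷ (1 , triple 15 17 22) ∷
  (6 , triple 15 18 20) ∷ (12 , triple 15 18 21) ∷ (4 , triple 15 18 22) ∷ (3 , triple 15 19 20) ∷ (13 , triple 15 19 21) ∷ (13 , triple 15 19 22) ∷
  (2 , triple 15 20 21) ∷ (19 , triple 15 21 22) ∷ (7 , triple 16 17 18) ∷ (11 , triple 16 17 19) ∷ (9 , triple 16 17 20) ∷ (5 , triple 16 17 23) ∷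
  (16 , triple 16 18 19) ∷ (8 , triple 16 18 20) ∷ (2 , triple 16 18 21) ∷ (13 , triple 16 18 22) ∷ (14 , triple 16 18 23) ∷ (17 , triple 16 19 20) ∷
  (7 , triple 16 19 21) ∷ (8 , triple 16 19 22) ∷ (2 , triple 16 19 23) ∷ (4 , triple 16 20 21) ∷ (4 , triple 16 20 22) ∷ (4 , triple 16 20 23) ∷
  (4 , triple 16 21 22) ∷ (13 , triple 16 21 23) ∷ (51 , triple 17 18 19) ∷ (12 , triple 17 18 20) ∷ (42 , triple 17 18 21) ∷ (1 , triple 17 18 22) ∷
  (4 , triple 17 19 20) ∷ (40 , triple 17 19 21) ∷ (13 , triple 17 19 22) ∷ (1 , triple 17 19 23) ∷ (4 , triple 17 20 21) ∷ (1 , triple 17 20 22) ∷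
  (1 , triple 17 20 23) ∷ (1 , triple 17 21 22) ∷ (9 , triple 17 21 23) ∷ (14 , triple 17 22 23) ∷ (5 , triple 18 19 20) ∷ (9 , triple 18 19 21) ∷
  (9 , triple 18 19 22) ∷ (49 , triple 18 19 23) ∷ (9 , triple 18 20 21) ∷ (1 , triple 18 20 22) ∷ (9 , triple 18 20 23) ∷ (1 , triple 18 21 23) ∷
  (11 , triple 19 20 21) ∷ (3 , triple 19 20 23) ∷ (11 , triple 19 21 22) ∷ (5 , triple 19 21 23) ∷ (1 , triple 19 22 23) ∷ (19 , triple 20 21 23) ∷
  (3 , triple 21 22 23) ∷
  []

pairsByFreq₈ : List (ℕ × ℕ)
pairsByFreq₈ =
  (8 , 11) ∷ (11 , 21) ∷ (11 , 20) ∷ (0 , 11) ∷ (11 , 23) ∷ (5 , 11) ∷ (1 , 11) ∷ (10 , 11) ∷ (11 , 14) ∷ (2 , 11) ∷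
  (7 , 11) ∷ (1 , 13) ∷ (9 , 11) ∷ (4 , 11) ∷ (11 , 18) ∷ (11 , 22) ∷ (11 , 15) ∷ (6 , 11) ∷ (11 , 17) ∷ (11 , 13) ∷
  (11 , 12) ∷ (9 , 13) ∷ (13 , 14) ∷ (4 , 13) ∷ (8 , 13) ∷ (13 , 18) ∷ (20 , 22) ∷ (0 , 13) ∷ (10 , 13) ∷ (13 , 22) ∷
  (8 , 14) ∷ (11 , 16) ∷ (13 , 16) ∷ (3 , 13) ∷ (2 , 13) ∷ (13 , 19) ∷ (12 , 13) ∷ (8 , 22) ∷ (12 , 22) ∷ (13 , 15) ∷
  (0 , 14) ∷ (13 , 23) ∷ (10 , 14) ∷ (6 , 13) ∷ (0 , 1) ∷ (7 , 13) ∷ (9 , 14) ∷ (14 , 23) ∷ (2 , 22) ∷ (22 , 23) ∷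
  (14 , 21) ∷ (14 , 18) ∷ (2 , 14) ∷ (14 , 19) ∷ (12 , 14) ∷ (0 , 7) ∷ (8 , 18) ∷ (7 , 19) ∷ (18 , 22) ∷ (0 , 10) ∷
  (2 , 20) ∷ (4 , 14) ∷ (13 , 17) ∷ (7 , 14) ∷ (7 , 12) ∷ (10 , 19) ∷ (12 , 21) ∷ (0 , 12) ∷ (0 , 20) ∷ (3 , 14) ∷
  (3 , 15) ∷ (14 , 16) ∷ (8 , 20) ∷ (1 , 21) ∷ (8 , 17) ∷ (8 , 19) ∷ (20 , 21) ∷ (5 , 22) ∷ (3 , 10) ∷ (8 , 12) ∷
  (2 , 6) ∷ (3 , 8) ∷ (16 , 22) ∷ (4 , 7) ∷ (0 , 2) ∷ (2 , 5) ∷ (2 , 15) ∷ (8 , 15) ∷ (7 , 8) ∷ (7 , 21) ∷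
  (3 , 12) ∷ (13 , 20) ∷ (1 , 15) ∷ (15 , 22) ∷ (1 , 12) ∷ (1 , 22) ∷ (12 , 15) ∷ (12 , 18) ∷ (4 , 15) ∷ (1 , 14) ∷
  (20 , 23) ∷ (19 , 22) ∷ (1 , 7) ∷ (9 , 20) ∷ (15 , 20) ∷ (9 , 22) ∷ (14 , 15) ∷ (0 , 4) ∷ (2 , 3) ∷ (10 , 15) ∷
  (16 , 21) ∷ (6 , 12) ∷ (7 , 18) ∷ (10 , 22) ∷ (7 , 9) ∷ (0 , 15) ∷ (1 , 10) ∷ (7 , 22) ∷ (15 , 18) ∷ (2 , 23) ∷
  (5 , 15) ∷ (21 , 22) ∷ (5 , 14) ∷ (6 , 17) ∷ (4 , 22) ∷ (4 , 19) ∷ (2 , 7) ∷ (0 , 3) ∷ (10 , 12) ∷ (10 , 20) ∷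
  (19 , 20) ∷ (10 , 21) ∷ (15 , 19) ∷ (9 , 12) ∷ (5 , 8) ∷ (0 , 22) ∷ (12 , 19) ∷ (14 , 20) ∷ (15 , 21) ∷ (7 , 16) ∷
  (7 , 20) ∷ (9 , 19) ∷ (3 , 22) ∷ (3 , 16) ∷ (5 , 19) ∷ (5 , 7) ∷ (1 , 23) ∷ (16 , 18) ∷ (0 , 9) ∷ (9 , 21) ∷
  (19 , 23) ∷ (9 , 15) ∷ (7 , 17) ∷ (0 , 21) ∷ (8 , 23) ∷ (14 , 17) ∷ (9 , 10) ∷ (2 , 4) ∷ (17 , 23) ∷ (3 , 4) ∷
  (0 , 19) ∷ (1 , 2) ∷ (8 , 21) ∷ (4 , 5) ∷ (1 , 8) ∷ (2 , 19) ∷ (2 , 16) ∷ (1 , 4) ∷ (3 , 20) ∷ (15 , 16) ∷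
  (3 , 21) ∷ (5 , 10) ∷ (15 , 17) ∷ (5 , 12) ∷ (9 , 18) ∷ (6 , 9) ∷ (1 , 19) ∷ (18 , 21) ∷ (10 , 23) ∷ (16 , 17) ∷
  (8 , 10) ∷ (3 , 9) ∷ (7 , 10) ∷ (18 , 23) ∷ (2 , 9) ∷ (0 , 5) ∷ (6 , 8) ∷ (2 , 21) ∷ (3 , 6) ∷ (12 , 23) ∷
  (1 , 16) ∷ (6 , 15) ∷ (21 , 23) ∷ (9 , 16) ∷ (4 , 18) ∷ (16 , 23) ∷ (1 , 6) ∷ (0 , 23) ∷ (4 , 8) ∷ (18 , 20) ∷
  (16 , 20) ∷ (3 , 17) ∷ (1 , 3) ∷ (0 , 18) ∷ (4 , 17) ∷ (12 , 17) ∷ (3 , 7) ∷ (4 , 23) ∷ (6 , 10) ∷ (1 , 18) ∷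
  (10 , 17) ∷ (3 , 5) ∷ (9 , 23) ∷ (19 , 21) ∷ (2 , 8) ∷ (6 , 7) ∷ (6 , 20) ∷ (2 , 17) ∷ (4 , 6) ∷ (16 , 19) ∷
  (5 , 6) ∷ (5 , 20) ∷ (1 , 5) ∷ (1 , 20) ∷ (17 , 18) ∷ (4 , 9) ∷ (4 , 10) ∷ (18 , 19) ∷ (2 , 12) ∷ (0 , 17) ∷
  (0 , 6) ∷ (3 , 23) ∷ (4 , 16) ∷ (8 , 9) ∷ (6 , 21) ∷ (5 , 18) ∷ (5 , 9) ∷ (17 , 20) ∷ (6 , 19) ∷ (5 , 17) ∷
  (4 , 21) ∷ (6 , 18) ∷ (17 , 21) ∷ (5 , 16) ∷ (3 , 18) ∷ (6 , 23) ∷ (12 , 16) ∷ (17 , 22) ∷ (10 , 16) ∷ (6 , 16) ∷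
  (17 , 19) ∷ (5 , 23) ∷
  []

proposition4p5 : (u : ℕ) → (u ≡ 4 ⊎ u ≡ 5 ⊎ u ≡ 8) → SBGDDExists 0 3 u
proposition4p5 _ (inj₁ refl)        = certifiedSBGDD 4 (fromTables blocks₄ pairsByFreq₄) tt
proposition4p5 _ (inj₂ (inj₁ refl)) = certifiedSBGDD 5 (fromTables blocks₅ pairsByFreq₅) tt
proposition4p5 _ (inj₂ (inj₂ refl)) = certifiedSBGDD 8 (fromTables blocks₈ pairsByFreq₈) tt
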